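{- (Representation theorem.) Let $\mathbf U=\langle\langle U,\approx\rangle,\preceq\rangle$ be a completely lattice $\mathbf L$-ordered set. The mapping ${\sim}\mapsto\langle{}_\sim,{}^\sim\rangle$ is an isomorphism of $\mathbf L$-ordered sets between $\mathrm{CTol}(\mathbf U)$ and $\mathrm{EIGal}(\mathbf U)$, with inverse $\langle f,g\rangle\mapsto{\sim_{\langle f,g\rangle}}$. Moreover, $\mathrm{CTol}(\mathbf U)$ and $\mathrm{EIGal}(\mathbf U)$ are both completely lattice $\mathbf L$-ordered sets.
   Context: $\mathbf L=\langle L,\wedge,\vee,\otimes,\to,0,1\rangle$ is a complete residuated lattice: $\langle L,\wedge,\vee,0,1\rangle$ is a complete lattice, $\langle L,\otimes,1\rangle$ is a commutative monoid, and $a\otimes b\le c$ iff $a\le b\to c$. An $\mathbf L$-set in $X$ is a map $A:X\to L$; $L^X$ is the set of all of them. Graded subsethood: $S(A,B)=\bigwedge_{x\in X}(A(x)\to B(x))$; $A\approx^X B=S(A,B)\wedge S(B,A)$. A binary $\mathbf L$-relation on $X$ is an $\mathbf L$-set in $X\times X$; reflexive: $R(x,x)=1$; symmetric: $R(x,y)=R(y,x)$; transitive: $R(x,y)\otimes R(y,z)\le R(x,z)$; an $\mathbf L$-equality is reflexive, symmetric, transitive with $R(x,y)=1\Rightarrow x=y$. An $\mathbf L$-ordered set is $\mathbf U=\langle\langle U,\approx\rangle,\preceq\rangle$, $\approx$ an $\mathbf L$-equality on $U$, $\preceq$ a binary $\mathbf L$-relation on $U$ which is reflexive, transitive, compatible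 with $\approx$ ($(u\preceq v)\otimes(u\approx u')\otimes(v\approx v')\le(u'\preceq v')$), and $(u\preceq v)\wedge(v\preceq u)\le u\approx v$. Write $u\le v$ iff $(u\preceq v)=1$. For $V\in L^U$: $\mathcal L V(v)=\bigwedge_{u}(V(u)\to(v\preceq u))$, $\mathcal U V(v)=\bigwedge_{u}(V(u)\to(u\preceq v))$; $\inf V$ is the unique $u$ with $\mathcal L V(u)=1=\mathcal U(\mathcal L V)(u)$, $\sup V$ the unique $u$ with $\mathcal U V(u)=1=\mathcal L(\mathcal U V)(u)$, if they exist; $\mathbf U$ is completely lattice $\mathbf L$-ordered if they exist for all $V\in L^U$. An isomorphism of $\mathbf L$-ordered sets is a bijection $h$ with $(u_1\preceq u_2)=(h(u_1)\preceq h(u_2))$. Power relation: for a binary $\mathbf L$-relation $R$ on $X$ and $A,B\in L^X$, $(R\circ B)(x)=\bigvee_y R(x,y)\otimes B(y)$, $(A\circ R)(y)=\bigvee_x A(x)\otimes R(x,y)$, $R^+(A,B)=S(A,R\circ B)\wedge S(B,A\circ R)$. A binary $\mathbf L$-relation $R$ on $\mathbf U$ is complete if it is compatible with $\approx$ and for all $V_1,V_2\in L^U$, $R^+(V_1,V_2)\le R(\inf V_1,\inf V_2)$ and $R^+(V_1,V_2)\le R(\sup V_1,\sup V_2)$. An $\mathbf L$-tolerance is a reflexive symmetric binary $\mathbf L$-relation. $\mathrm{CTol}(\mathbf U)$ is the set of complete $\mathbf L$-tolerances on $\mathbf U$, equipped with the $\mathbf L$-equality $\approx^{U\times U}$ and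 the $\mathbf L$-order $S$. For $\sim\in\mathrm{CTol}(\mathbf U)$ and $u\in U$: $[u]_\sim(v)=u\sim v$, $u_\sim=\inf[u]_\sim$, $u^\sim=\sup[u]_\sim$. An isotone $\mathbf L$-Galois connection on $\mathbf U$ is a pair $\langle f,g\rangle$ of maps $U\to U$ with $(f(u)\preceq v)=(u\preceq g(v))$ for all $u,v$; it is extensive if $f(u)\le u$ and $g(u)\ge u$ for all $u$. $\mathrm{EIGal}(\mathbf U)$ is the set of extensive isotone $\mathbf L$-Galois connections on $\mathbf U$, equipped with $\langle f_1,g_1\rangle\approx\langle f_2,g_2\rangle=\bigwedge_u(f_2(u)\approx f_1(u))\wedge\bigwedge_v(g_1(v)\approx g_2(v))$ and $\langle f_1,g_1\rangle\preceq\langle f_2,g_2\rangle=\bigwedge_u(f_2(u)\preceq f_1(u))\wedge\bigwedge_v(g_1(v)\preceq g_2(v))$. For $\langle f,g\rangle\in\mathrm{EIGal}(\mathbf U)$, $u\sim_{\langle f,g\rangle}v=(f(u)\preceq v)\wedge(v\preceq g(u))$. -}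

module Defs where

open import Data.Product using (Σ; _×_; _,_; proj₁; proj₂)
open import Relation.Binary.PropositionalEquality using (_≡_; cong)
open import Relation.Binary.Structures using (IsEquivalence)

record CRL : Set₁ where
  infix  4 _≤_
  infixr 6 _∧_ _∨_
  infixr 7 _⊗_
  infixr 5 _⇒_
  field
    L         : Set
    _≤_       : L → L → Set
    ≤-refl    : ∀ {a} → a ≤ a
    ≤-trans   : ∀ {a b c} → a ≤ b → b ≤ c → a ≤ c
    ≤-antisym : ∀ {a b} → a ≤ b → b ≤ a → a ≡ b
    ⋀         : {I : Set} → (I → L) → L
    ⋀-lb      : ∀ {I : Set} (a : I → L) (i : I) → ⋀ a ≤ a i
    ⋀-glb     : ∀ {I : Set} (a : I → L) (b : L) → (∀ i → b ≤ a i) → b ≤ ⋀ a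
    ⋁         : {I : Set} → (I → L) → L
    ⋁-ub      : ∀ {I : Set} (a : I → L) (i : I) → a i ≤ ⋁ a
    ⋁-lub     : ∀ {I : Set} (a : I → L) (b : L) → (∀ i → a i ≤ b) → ⋁ a ≤ b
    _∧_       : L → L → L
    ∧-lb₁     : ∀ a b → a ∧ b ≤ a
    ∧-lb₂     : ∀ a b → a ∧ b ≤ b
    ∧-glb     : ∀ a b c → c ≤ a → c ≤ b → c ≤ a ∧ b
    _∨_       : L → L → L
    ∨-ub₁     : ∀ a b → a ≤ a ∨ b
    ∨-ub₂     : ∀ a b → b ≤ a ∨ b
    ∨-lub     : ∀ a b c → a ≤ c → b ≤ c → a ∨ b ≤ c
    𝟘         : L
    𝟙         : L
    𝟘-min     : ∀ a → 𝟘 ≤ a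
    𝟙-max     : ∀ a → a ≤ 𝟙
    _⊗_       : L → L → L
    ⊗-assoc   : ∀ a b c → (a ⊗ b) ⊗ c ≡ a ⊗ (b ⊗ c)
    ⊗-comm    : ∀ a b → a ⊗ b ≡ b ⊗ a
    ⊗-identˡ  : ∀ a → 𝟙 ⊗ a ≡ a
    _⇒_       : L → L → L
    adj→      : ∀ {a b c} → a ⊗ b ≤ c → a ≤ b ⇒ c
    adj←      : ∀ {a b c} → a ≤ b ⇒ c → a ⊗ b ≤ c

module Over (𝐋 : CRL) where
  open CRL 𝐋 public

  S : {X : Set} → (X → L) → (X → L) → L
  S A B = ⋀ (λ x → A x ⇒ B x)

  _≈ˢ_ : {X : Set} → (X → L) → (X → L) → L
  A ≈ˢ B = S A B ∧ S B A

  -- Raw L-ordered structures.  The carrier comes with a crisp equality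
  -- _≐_ (a setoid), needed because the carriers CTol / EIGal consist of
  -- functions; for U itself _≐_ is _≡_.
  record RawLOrd : Set₁ where
    field
      Carrier : Set
      _≐_     : Carrier → Carrier → Set
      _≈_     : Carrier → Carrier → L
      _⪯_     : Carrier → Carrier → L

  module _ (P : RawLOrd) where
    open RawLOrd P

    record IsLOrdered : Set where
      field
        ≐-equiv   : IsEquivalence _≐_
        ≈-resp    : ∀ {x x' y y'} → x ≐ x' → y ≐ y' → (x ≈ y) ≡ (x' ≈ y')
        ⪯-resp    : ∀ {x x' y y'} → x ≐ x' → y ≐ y' → (x ⪯ y) ≡ (x' ⪯ y')
        ≈-refl    : ∀ x → (x ≈ x) ≡ 𝟙
        ≈-sym     : ∀ x y → (x ≈ y) ≡ (y ≈ x)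
        ≈-trans   : ∀ x y z → (x ≈ y) ⊗ (y ≈ z) ≤ (x ≈ z)
        ≈-sep     : ∀ x y → (x ≈ y) ≡ 𝟙 → x ≐ y
        ⪯-refl    : ∀ x → (x ⪯ x) ≡ 𝟙
        ⪯-trans   : ∀ x y z → (x ⪯ y) ⊗ (y ⪯ z) ≤ (x ⪯ z)
        ⪯-compat  : ∀ u v u' v' → ((u ⪯ v) ⊗ (u ≈ u')) ⊗ (v ≈ v') ≤ (u' ⪯ v')
        ⪯-antisym : ∀ u v → (u ⪯ v) ∧ (v ⪯ u) ≤ (u ≈ v)

    Ext : (Carrier → L) → Set
    Ext V = ∀ x y → x ≐ y → V x ≡ V y

    LowerCone UpperCone : (Carrier → L) → (Carrier → L)
    LowerCone V v = ⋀ (λ u → V u ⇒ (v ⪯ u))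
    UpperCone V v = ⋀ (λ u → V u ⇒ (u ⪯ v))

    IsInf IsSup : (Carrier → L) → Carrier → Set
    IsInf V u = (LowerCone V u ≡ 𝟙) × (UpperCone (LowerCone V) u ≡ 𝟙)
    IsSup V u = (UpperCone V u ≡ 𝟙) × (LowerCone (UpperCone V) u ≡ 𝟙)

    record IsCompletelyLatticeLOrdered : Set where
      field
        isLOrdered : IsLOrdered
        inf        : ∀ V → Ext V → Σ Carrier (IsInf V)
        sup        : ∀ V → Ext V → Σ Carrier (IsSup V)

  record IsIso (P Q : RawLOrd)
               (h : RawLOrd.Carrier P → RawLOrd.Carrier Q)
               (h' : RawLOrd.Carrier Q → RawLOrd.Carrier P) : Set where
    private
      module P = RawLOrd P
      module Q = RawLOrd Q
    field
      h-resp    : ∀ {x y} → x P.≐ y → h x Q.≐ h y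
      h'-resp   : ∀ {x y} → x Q.≐ y → h' x P.≐ h' y
      left-inv  : ∀ x → h' (h x) P.≐ x
      right-inv : ∀ y → h (h' y) Q.≐ y
      ⪯-pres    : ∀ x y → (x P.⪯ y) ≡ (h x Q.⪯ h y)

  rawU : (U : Set) → (U → U → L) → (U → U → L) → RawLOrd
  rawU U _≈_ _⪯_ = record { Carrier = U ; _≐_ = _≡_ ; _≈_ = _≈_ ; _⪯_ = _⪯_ }

  module OnU (U : Set) (_≈_ _⪯_ : U → U → L)
             (cl : IsCompletelyLatticeLOrdered (rawU U _≈_ _⪯_)) where
    open IsCompletelyLatticeLOrdered cl using (isLOrdered)

    inf sup : (U → L) → U
    inf V = proj₁ (IsCompletelyLatticeLOrdered.inf cl V (λ _ _ e → cong V e))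
    sup V = proj₁ (IsCompletelyLatticeLOrdered.sup cl V (λ _ _ e → cong V e))

    LRel : Set
    LRel = U × U → L

    _∘ʳ_ : LRel → (U → L) → (U → L)
    (R ∘ʳ B) x = ⋁ (λ y → R (x , y) ⊗ B y)

    _∘ˡ_ : (U → L) → LRel → (U → L)
    (A ∘ˡ R) y = ⋁ (λ x → A x ⊗ R (x , y))

    _⁺ : LRel → (U → L) → (U → L) → L
    (R ⁺) A B = S A (R ∘ʳ B) ∧ S B (A ∘ˡ R)

    IsReflexive IsSymmetric IsCompatible IsCompleteRel IsTolerance : LRel → Set
    IsReflexive R = ∀ x → R (x , x) ≡ 𝟙
    IsSymmetric R = ∀ x y → R (x , y) ≡ R (y , x)
    IsCompatible R = ∀ u v u' v' → (R (u , v) ⊗ (u ≈ u')) ⊗ (v ≈ v') ≤ R (u' , v')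
    IsCompleteRel R = IsCompatible R
                    × (∀ V₁ V₂ → (R ⁺) V₁ V₂ ≤ R (inf V₁ , inf V₂))
                    × (∀ V₁ V₂ → (R ⁺) V₁ V₂ ≤ R (sup V₁ , sup V₂))
    IsTolerance R = IsReflexive R × IsSymmetric R

    IsCTol : LRel → Set
    IsCTol R = IsTolerance R × IsCompleteRel R

    CTol : RawLOrd
    CTol = record
      { Carrier = Σ LRel IsCTol
      ; _≐_ = λ R₁ R₂ → ∀ p → proj₁ R₁ p ≡ proj₁ R₂ p
      ; _≈_ = λ R₁ R₂ → proj₁ R₁ ≈ˢ proj₁ R₂
      ; _⪯_ = λ R₁ R₂ → S (proj₁ R₁) (proj₁ R₂)
      }

    Pair : Set
    Pair = (U → U) × (U → U)

    IsIGal IsExtensive IsEIGal : Pair → Set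
    IsIGal (f , g) = ∀ u v → (f u ⪯ v) ≡ (u ⪯ g v)
    IsExtensive (f , g) = (∀ u → (f u ⪯ u) ≡ 𝟙) × (∀ u → (u ⪯ g u) ≡ 𝟙)
    IsEIGal p = IsIGal p × IsExtensive p

    EIGal : RawLOrd
    EIGal = record
      { Carrier = Σ Pair IsEIGal
      ; _≐_ = λ p₁ p₂ → (∀ u → proj₁ (proj₁ p₁) u ≡ proj₁ (proj₁ p₂) u)
                      × (∀ u → proj₂ (proj₁ p₁) u ≡ proj₂ (proj₁ p₂) u)
      ; _≈_ = λ p₁ p₂ → ⋀ (λ u → proj₁ (proj₁ p₂) u ≈ proj₁ (proj₁ p₁) u)
                      ∧ ⋀ (λ v → proj₂ (proj₁ p₁) v ≈ proj₂ (proj₁ p₂) v)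
      ; _⪯_ = λ p₁ p₂ → ⋀ (λ u → proj₁ (proj₁ p₂) u ⪯ proj₁ (proj₁ p₁) u)
                      ∧ ⋀ (λ v → proj₂ (proj₁ p₁) v ⪯ proj₂ (proj₁ p₂) v)
      }

    class : LRel → U → (U → L)
    class R u v = R (u , v)

    lower upper : LRel → U → U
    lower R u = inf (class R u)
    upper R u = sup (class R u)

    -- ∼ ↦ ⟨ _∼ , ^∼ ⟩  and  ⟨f,g⟩ ↦ ∼_{⟨f,g⟩}
    toGal : LRel → Pair
    toGal R = lower R , upper R

    toTol : Pair → LRel
    toTol (f , g) (u , v) = (f u ⪯ v) ∧ (v ⪯ g u)

    φ : (∀ R → IsCTol R → IsEIGal (toGal R)) →
        RawLOrd.Carrier CTol → RawLOrd.Carrier EIGal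
    φ w (R , r) = toGal R , w R r

    ψ : (∀ p → IsEIGal p → IsCTol (toTol p)) →
        RawLOrd.Carrier EIGal → RawLOrd.Carrier CTol
    ψ w (p , e) = toTol p , w p e

module Submission where

-- Completeness of a tolerance ∼, applied to the singleton {u} and the class [u]∼, gives
-- u ∼ u_∼ and u ∼ u^∼; applied to two-element sets it makes u ↦ u_∼ and u ↦ u^∼ isotone,
-- which yields the Galois property, and it exhibits (u_∼ ⪯ v) ∧ (v ⪯ u^∼) ≤ u ∼ v, so ∼ is
-- recovered from ⟨_∼ , ^∼⟩. Conversely, isotonicity of f and g is exactly what makes ∼⟨f,g⟩
-- complete. Complete tolerances are closed under graded
-- intersections, which are infima in CTol; suprema are infima of upper cones, and EIGal
-- inherits its infima through the isomorphism.

open import Defs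
open import Data.Product using (Σ; _×_; _,_; proj₁; proj₂; Σ-syntax)
open import Relation.Binary.PropositionalEquality using (_≡_; refl; sym; trans; cong; cong₂; module ≡-Reasoning)
open import Relation.Binary.Structures using (IsEquivalence)

module Residuated (𝐋 : CRL) where
  open CRL 𝐋

  infixr 2 _▸_
  _▸_ : ∀ {a b c} → a ≤ b → b ≤ c → a ≤ c
  _▸_ = ≤-trans

  ≤-reflexive : ∀ {a b} → a ≡ b → a ≤ b
  ≤-reflexive refl = ≤-refl

  𝟙≤⇒≡𝟙 : ∀ {a} → 𝟙 ≤ a → a ≡ 𝟙
  𝟙≤⇒≡𝟙 = ≤-antisym (𝟙-max _)

  ≡𝟙⇒𝟙≤ : ∀ {a} → a ≡ 𝟙 → 𝟙 ≤ a
  ≡𝟙⇒𝟙≤ e = ≤-reflexive (sym e)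

  ∧-comm : ∀ a b → a ∧ b ≡ b ∧ a
  ∧-comm a b = ≤-antisym (∧-glb b a _ (∧-lb₂ a b) (∧-lb₁ a b))
                         (∧-glb a b _ (∧-lb₂ b a) (∧-lb₁ b a))

  ∧-mono : ∀ {a b c d} → a ≤ b → c ≤ d → a ∧ c ≤ b ∧ d
  ∧-mono p q = ∧-glb _ _ _ (∧-lb₁ _ _ ▸ p) (∧-lb₂ _ _ ▸ q)

  ∧-interchange : ∀ a b c d → (a ∧ b) ∧ (c ∧ d) ≡ (a ∧ c) ∧ (b ∧ d)
  ∧-interchange a b c d = ≤-antisym interchange interchange
    where
    interchange : ∀ {a b c d} → (a ∧ b) ∧ (c ∧ d) ≤ (a ∧ c) ∧ (b ∧ d)
    interchange = ∧-glb _ _ _ (∧-mono (∧-lb₁ _ _) (∧-lb₁ _ _)) (∧-mono (∧-lb₂ _ _) (∧-lb₂ _ _))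

  ⋀-cong : ∀ {I : Set} {a b : I → L} → (∀ i → a i ≡ b i) → ⋀ a ≡ ⋀ b
  ⋀-cong {a = a} {b} e = ≤-antisym (⋀-glb b _ (λ i → ⋀-lb a i ▸ ≤-reflexive (e i)))
                                   (⋀-glb a _ (λ i → ⋀-lb b i ▸ ≤-reflexive (sym (e i))))

  ⋀-𝟙 : ∀ {I : Set} {a : I → L} → (∀ i → 𝟙 ≤ a i) → ⋀ a ≡ 𝟙
  ⋀-𝟙 h = 𝟙≤⇒≡𝟙 (⋀-glb _ 𝟙 h)

  ⋀-∧ : ∀ {I : Set} (a b : I → L) → ⋀ (λ i → a i ∧ b i) ≡ ⋀ a ∧ ⋀ b
  ⋀-∧ a b = ≤-antisym
    (∧-glb _ _ _ (⋀-glb a _ (λ i → ⋀-lb _ i ▸ ∧-lb₁ _ _)) (⋀-glb b _ (λ i → ⋀-lb _ i ▸ ∧-lb₂ _ _)))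
    (⋀-glb _ _ (λ i → ∧-mono (⋀-lb a i) (⋀-lb b i)))

  ⊗-identityʳ : ∀ a → a ⊗ 𝟙 ≡ a
  ⊗-identityʳ a = trans (⊗-comm a 𝟙) (⊗-identˡ a)

  ⊗-comm-≤ : ∀ {a b} → a ⊗ b ≤ b ⊗ a
  ⊗-comm-≤ = ≤-reflexive (⊗-comm _ _)

  ⊗-assocʳ : ∀ {a b c} → (a ⊗ b) ⊗ c ≤ a ⊗ (b ⊗ c)
  ⊗-assocʳ = ≤-reflexive (⊗-assoc _ _ _)

  ⊗-assocˡ : ∀ {a b c} → a ⊗ (b ⊗ c) ≤ (a ⊗ b) ⊗ c
  ⊗-assocˡ = ≤-reflexive (sym (⊗-assoc _ _ _))

  ⊗-monoˡ : ∀ {a b c} → a ≤ b → a ⊗ c ≤ b ⊗ c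
  ⊗-monoˡ p = adj← (p ▸ adj→ ≤-refl)

  ⊗-monoʳ : ∀ {a b c} → a ≤ b → c ⊗ a ≤ c ⊗ b
  ⊗-monoʳ p = ⊗-comm-≤ ▸ ⊗-monoˡ p ▸ ⊗-comm-≤

  ⊗-mono : ∀ {a b c d} → a ≤ b → c ≤ d → a ⊗ c ≤ b ⊗ d
  ⊗-mono p q = ⊗-monoˡ p ▸ ⊗-monoʳ q

  ⊗-swapʳ : ∀ {a b c} → (a ⊗ b) ⊗ c ≤ (a ⊗ c) ⊗ b
  ⊗-swapʳ = ⊗-assocʳ ▸ ⊗-monoʳ ⊗-comm-≤ ▸ ⊗-assocˡ

  x⊗y≤y : ∀ {a b} → a ⊗ b ≤ b
  x⊗y≤y {a} {b} = ⊗-monoˡ (𝟙-max a) ▸ ≤-reflexive (⊗-identˡ b)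

  𝟙≤⇒≤⊗ˡ : ∀ {a b} → 𝟙 ≤ a → b ≤ a ⊗ b
  𝟙≤⇒≤⊗ˡ {b = b} p = ≤-reflexive (sym (⊗-identˡ b)) ▸ ⊗-monoˡ p

  𝟙≤⇒≤⊗ʳ : ∀ {a b} → 𝟙 ≤ a → b ≤ b ⊗ a
  𝟙≤⇒≤⊗ʳ {b = b} p = ≤-reflexive (sym (⊗-identityʳ b)) ▸ ⊗-monoʳ p

  ⊗-∨-lub : ∀ {a b c d} → c ⊗ a ≤ d → c ⊗ b ≤ d → c ⊗ (a ∨ b) ≤ d
  ⊗-∨-lub p q = ⊗-comm-≤ ▸ adj← (∨-lub _ _ _ (adj→ (⊗-comm-≤ ▸ p)) (adj→ (⊗-comm-≤ ▸ q)))

  ⇒-mp : ∀ {a b} → (a ⇒ b) ⊗ a ≤ b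
  ⇒-mp = adj← ≤-refl

  𝟙≤⇒⇒≤ : ∀ {a b} → 𝟙 ≤ a ⇒ b → a ≤ b
  𝟙≤⇒⇒≤ {a} p = ≤-reflexive (sym (⊗-identˡ a)) ▸ adj← p

  ≤⇒𝟙≤⇒ : ∀ {a b} → a ≤ b → 𝟙 ≤ a ⇒ b
  ≤⇒𝟙≤⇒ {a} p = adj→ (≤-reflexive (⊗-identˡ a) ▸ p)

  ⇒-𝟙-antecedent : ∀ {a b} → 𝟙 ≤ a → a ⇒ b ≤ b
  ⇒-𝟙-antecedent p = 𝟙≤⇒≤⊗ʳ p ▸ ⇒-mp

  ≤-⋀⇒ : ∀ {I : Set} {a b : I → L} {c} → (∀ i → c ⊗ a i ≤ b i) → c ≤ ⋀ (λ i → a i ⇒ b i)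
  ≤-⋀⇒ h = ⋀-glb _ _ (λ i → adj→ (h i))

  ⋀⇒-elim : ∀ {I : Set} {a b : I → L} {c} → c ≤ ⋀ (λ i → a i ⇒ b i) → ∀ i → c ⊗ a i ≤ b i
  ⋀⇒-elim p i = adj← (p ▸ ⋀-lb _ i)

module LOrderedSets (𝐋 : CRL) where
  open Over 𝐋
  open Residuated 𝐋

  module _ (P : RawLOrd) where
    open RawLOrd P

    inf-lower : ∀ {V s} → IsInf P V s → ∀ x → V x ≤ s ⪯ x
    inf-lower (e , _) x = 𝟙≤⇒⇒≤ (≡𝟙⇒𝟙≤ e ▸ ⋀-lb _ x)

    inf-greatest : ∀ {V s} → IsInf P V s → ∀ w → LowerCone P V w ≤ w ⪯ s
    inf-greatest (_ , e) w = 𝟙≤⇒⇒≤ (≡𝟙⇒𝟙≤ e ▸ ⋀-lb _ w)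

    sup-upper : ∀ {V s} → IsSup P V s → ∀ x → V x ≤ x ⪯ s
    sup-upper (e , _) x = 𝟙≤⇒⇒≤ (≡𝟙⇒𝟙≤ e ▸ ⋀-lb _ x)

    sup-least : ∀ {V s} → IsSup P V s → ∀ w → UpperCone P V w ≤ s ⪯ w
    sup-least (_ , e) w = 𝟙≤⇒⇒≤ (≡𝟙⇒𝟙≤ e ▸ ⋀-lb _ w)

    lowerCone-cong : ∀ {V W} → (∀ x → V x ≡ W x) → ∀ w → LowerCone P V w ≡ LowerCone P W w
    lowerCone-cong e w = ⋀-cong (λ x → cong (_⇒ _) (e x))

    upperCone-cong : ∀ {V W} → (∀ x → V x ≡ W x) → ∀ w → UpperCone P V w ≡ UpperCone P W w
    upperCone-cong e w = ⋀-cong (λ x → cong (_⇒ _) (e x))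

    isInf-cong : ∀ {V W s} → (∀ x → V x ≡ W x) → IsInf P W s → IsInf P V s
    isInf-cong e (p , q) = trans (lowerCone-cong e _) p , trans (upperCone-cong (lowerCone-cong e) _) q

    isSup-cong : ∀ {V W s} → (∀ x → V x ≡ W x) → IsSup P W s → IsSup P V s
    isSup-cong e (p , q) = trans (upperCone-cong e _) p , trans (lowerCone-cong (upperCone-cong e) _) q

    inf-upperCone⇒sup : ∀ {V s} → IsInf P (UpperCone P V) s → IsSup P V s
    inf-upperCone⇒sup {V} i = ⋀-𝟙 (λ u → ≤⇒𝟙≤⇒ (below-lowerCone u ▸ inf-greatest i u)) , proj₁ i
      where
      below-lowerCone : ∀ u → V u ≤ LowerCone P (UpperCone P V) u
      below-lowerCone u = ≤-⋀⇒ (λ w → ⊗-comm-≤ ▸ ⋀⇒-elim ≤-refl u)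

    sups-from-infs : IsLOrdered P →
                     (∀ V → Ext P V → Σ Carrier (IsInf P V)) →
                     (∀ V → Ext P V → Σ Carrier (IsSup P V))
    sups-from-infs isLOrd infs V _ = proj₁ s , inf-upperCone⇒sup (proj₂ s)
      where
      open IsLOrdered isLOrd using (≐-equiv; ⪯-resp)
      upperCone-ext : Ext P (UpperCone P V)
      upperCone-ext x y e =
        ⋀-cong (λ u → cong (V u ⇒_) (⪯-resp (IsEquivalence.refl ≐-equiv) e))
      s : Σ Carrier (IsInf P (UpperCone P V))
      s = infs (UpperCone P V) upperCone-ext

    isLOrdered-fromSymmetrised :
      IsEquivalence _≐_ →
      (∀ {x x' y y'} → x ≐ x' → y ≐ y' → (x ⪯ y) ≡ (x' ⪯ y')) →
      (∀ x y → (x ≈ y) ≡ (x ⪯ y) ∧ (y ⪯ x)) →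
      (∀ x → (x ⪯ x) ≡ 𝟙) →
      (∀ x y z → (x ⪯ y) ⊗ (y ⪯ z) ≤ (x ⪯ z)) →
      (∀ x y → 𝟙 ≤ x ⪯ y → 𝟙 ≤ y ⪯ x → x ≐ y) →
      IsLOrdered P
    isLOrdered-fromSymmetrised ≐-equiv ⪯-resp ≈-def ⪯-refl ⪯-trans ⪯-sep = record
      { ≐-equiv   = ≐-equiv
      ; ≈-resp    = λ {x} {x'} {y} {y'} ex ey →
          trans (≈-def x y) (trans (cong₂ _∧_ (⪯-resp ex ey) (⪯-resp ey ex)) (sym (≈-def x' y')))
      ; ⪯-resp    = ⪯-resp
      ; ≈-refl    = λ x → trans (≈-def x x)
          (𝟙≤⇒≡𝟙 (∧-glb _ _ _ (≡𝟙⇒𝟙≤ (⪯-refl x)) (≡𝟙⇒𝟙≤ (⪯-refl x))))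
      ; ≈-sym     = λ x y → trans (≈-def x y) (trans (∧-comm _ _) (sym (≈-def y x)))
      ; ≈-trans   = λ x y z → ∧-glb _ _ _
          (⊗-mono ≈⇒⪯ ≈⇒⪯ ▸ ⪯-trans x y z)
          (⊗-comm-≤ ▸ ⊗-mono ≈⇒⪰ ≈⇒⪰ ▸ ⪯-trans z y x)
        ▸ ≤-reflexive (sym (≈-def x z))
      ; ≈-sep     = λ x y e → ⪯-sep x y (≡𝟙⇒𝟙≤ e ▸ ≈⇒⪯) (≡𝟙⇒𝟙≤ e ▸ ≈⇒⪰)
      ; ⪯-refl    = ⪯-refl
      ; ⪯-trans   = ⪯-trans
      ; ⪯-compat  = λ u v u' v' →
          ⊗-mono (⊗-mono ≤-refl ≈⇒⪰) ≈⇒⪯ ▸ ⊗-monoˡ (⊗-comm-≤ ▸ ⪯-trans u' u v) ▸ ⪯-trans u' v v'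
      ; ⪯-antisym = λ u v → ≤-reflexive (sym (≈-def u v))
      }
      where
      ≈⇒⪯ : ∀ {x y} → x ≈ y ≤ x ⪯ y
      ≈⇒⪯ {x} {y} = ≤-reflexive (≈-def x y) ▸ ∧-lb₁ _ _
      ≈⇒⪰ : ∀ {x y} → x ≈ y ≤ y ⪯ x
      ≈⇒⪰ {x} {y} = ≤-reflexive (≈-def x y) ▸ ∧-lb₂ _ _

  module _ {X : Set} where
    S-cong : ∀ {A A' B B' : X → L} → (∀ x → A x ≡ A' x) → (∀ x → B x ≡ B' x) → S A B ≡ S A' B'
    S-cong eA eB = ⋀-cong (λ x → cong₂ _⇒_ (eA x) (eB x))

    S-refl : ∀ (A : X → L) → 𝟙 ≤ S A A
    S-refl A = ⋀-glb _ _ (λ x → ≤⇒𝟙≤⇒ ≤-refl)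

    S-trans : ∀ {A B C : X → L} → S A B ⊗ S B C ≤ S A C
    S-trans = ≤-⋀⇒ (λ x → ⊗-swapʳ ▸ ⊗-monoˡ (⋀⇒-elim ≤-refl x) ▸ ⊗-comm-≤ ▸ ⋀⇒-elim ≤-refl x)

    S-antisym : ∀ {A B : X → L} → 𝟙 ≤ S A B → 𝟙 ≤ S B A → ∀ x → A x ≡ B x
    S-antisym p q x = ≤-antisym (𝟙≤⇒⇒≤ (p ▸ ⋀-lb _ x)) (𝟙≤⇒⇒≤ (q ▸ ⋀-lb _ x))

  infs-transport : ∀ {P Q h h'} → IsIso P Q h h' → IsLOrdered Q →
                   (∀ V → Ext P V → Σ (RawLOrd.Carrier P) (IsInf P V)) →
                   (∀ V → Ext Q V → Σ (RawLOrd.Carrier Q) (IsInf Q V))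
  infs-transport {P} {Q} {h} {h'} iso isLOrdQ infs V ext =
    h s , ⋀-𝟙 (λ q → ≤⇒𝟙≤⇒ (lower q)) , ⋀-𝟙 (λ q → ≤⇒𝟙≤⇒ (greatest q))
    where
    module P = RawLOrd P
    module Q = RawLOrd Q
    open IsIso iso
    open IsLOrdered isLOrdQ using (≐-equiv; ⪯-resp)
    open IsEquivalence ≐-equiv using () renaming (refl to ≐-refl; sym to ≐-sym)
    V' : P.Carrier → L
    V' x = V (h x)
    inf' : Σ P.Carrier (IsInf P V')
    inf' = infs V' (λ x y e → ext (h x) (h y) (h-resp e))
    s : P.Carrier
    s = proj₁ inf'
    lower : ∀ q → V q ≤ h s Q.⪯ q
    lower q = ≤-reflexive (ext q (h (h' q)) (≐-sym (right-inv q)))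
            ▸ inf-lower P (proj₂ inf') (h' q)
            ▸ ≤-reflexive (trans (⪯-pres s (h' q)) (⪯-resp ≐-refl (right-inv q)))
    greatest : ∀ q → LowerCone Q V q ≤ q Q.⪯ h s
    greatest q = ≤-⋀⇒ (λ x → ⋀⇒-elim ≤-refl (h x)
                           ▸ ≤-reflexive (sym (trans (⪯-pres (h' q) x) (⪯-resp (right-inv q) ≐-refl))))
               ▸ inf-greatest P (proj₂ inf') (h' q)
               ▸ ≤-reflexive (trans (⪯-pres (h' q) s) (⪯-resp (right-inv q) ≐-refl))

module CompletelyLatticeLOrdered
  (𝐋 : CRL) (U : Set) (_≈_ _⪯_ : U → U → CRL.L 𝐋)
  (cl : Over.IsCompletelyLatticeLOrdered 𝐋 (Over.rawU 𝐋 U _≈_ _⪯_)) where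
  open Over 𝐋
  open Residuated 𝐋
  open LOrderedSets 𝐋
  open OnU U _≈_ _⪯_ cl
  open IsLOrdered (IsCompletelyLatticeLOrdered.isLOrdered cl)

  𝐔 : RawLOrd
  𝐔 = rawU U _≈_ _⪯_

  infix 4 _⊑_
  _⊑_ : U → U → Set
  u ⊑ v = 𝟙 ≤ u ⪯ v

  ⊑-refl : ∀ u → u ⊑ u
  ⊑-refl u = ≡𝟙⇒𝟙≤ (⪯-refl u)

  ⪯-trans′ : ∀ {x y z} → (x ⪯ y) ⊗ (y ⪯ z) ≤ x ⪯ z
  ⪯-trans′ = ⪯-trans _ _ _

  ⊑-⪯-trans : ∀ {x y z} → x ⊑ y → y ⪯ z ≤ x ⪯ z
  ⊑-⪯-trans p = 𝟙≤⇒≤⊗ˡ p ▸ ⪯-trans′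

  ⪯-⊑-trans : ∀ {x y z} → y ⊑ z → x ⪯ y ≤ x ⪯ z
  ⪯-⊑-trans p = 𝟙≤⇒≤⊗ʳ p ▸ ⪯-trans′

  ≈⇒⪯ : ∀ {x y} → x ≈ y ≤ x ⪯ y
  ≈⇒⪯ {x} = 𝟙≤⇒≤⊗ˡ (𝟙≤⇒≤⊗ˡ (⊑-refl x) ▸ ⊗-monoʳ (≡𝟙⇒𝟙≤ (≈-refl x))) ▸ ⪯-compat x x x _

  ≈⇒⪰ : ∀ {x y} → x ≈ y ≤ y ⪯ x
  ≈⇒⪰ {x} {y} = ≤-reflexive (≈-sym x y) ▸ ≈⇒⪯

  ≈-symmetrised : ∀ x y → (x ≈ y) ≡ (x ⪯ y) ∧ (y ⪯ x)
  ≈-symmetrised x y = ≤-antisym (∧-glb _ _ _ ≈⇒⪯ ≈⇒⪰) (⪯-antisym x y)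

  ≤-≈ : ∀ {a b c} → c ≤ a ⪯ b → c ≤ b ⪯ a → c ≤ a ≈ b
  ≤-≈ p q = ∧-glb _ _ _ p q ▸ ⪯-antisym _ _

  ⊑-antisym : ∀ {a b} → a ⊑ b → b ⊑ a → a ≡ b
  ⊑-antisym p q = ≈-sep _ _ (𝟙≤⇒≡𝟙 (≤-≈ p q))

  inf-isInf : ∀ V → IsInf 𝐔 V (inf V)
  inf-isInf V = proj₂ (IsCompletelyLatticeLOrdered.inf cl V (λ _ _ e → cong V e))

  sup-isSup : ∀ V → IsSup 𝐔 V (sup V)
  sup-isSup V = proj₂ (IsCompletelyLatticeLOrdered.sup cl V (λ _ _ e → cong V e))

  inf-unique : ∀ {V a b} → IsInf 𝐔 V a → IsInf 𝐔 V b → a ≡ b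
  inf-unique ia ib = ⊑-antisym (≡𝟙⇒𝟙≤ (proj₁ ia) ▸ inf-greatest 𝐔 ib _)
                               (≡𝟙⇒𝟙≤ (proj₁ ib) ▸ inf-greatest 𝐔 ia _)

  sup-unique : ∀ {V a b} → IsSup 𝐔 V a → IsSup 𝐔 V b → a ≡ b
  sup-unique ia ib = ⊑-antisym (≡𝟙⇒𝟙≤ (proj₁ ib) ▸ sup-least 𝐔 ia _)
                               (≡𝟙⇒𝟙≤ (proj₁ ia) ▸ sup-least 𝐔 ib _)

  inf-cong : ∀ {V W} → (∀ x → V x ≡ W x) → inf V ≡ inf W
  inf-cong {V} {W} e = inf-unique (inf-isInf V) (isInf-cong 𝐔 e (inf-isInf W))

  sup-cong : ∀ {V W} → (∀ x → V x ≡ W x) → sup V ≡ sup W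
  sup-cong {V} {W} e = sup-unique (sup-isSup V) (isSup-cong 𝐔 e (sup-isSup W))

  singleton : U → U → L
  singleton u x = x ≈ u

  inf-singleton : ∀ u → IsInf 𝐔 (singleton u) u
  inf-singleton u = ⋀-𝟙 (λ x → ≤⇒𝟙≤⇒ ≈⇒⪰)
                  , ⋀-𝟙 (λ w → ≤⇒𝟙≤⇒ (⋀-lb _ u ▸ ⇒-𝟙-antecedent (≡𝟙⇒𝟙≤ (≈-refl u))))

  sup-singleton : ∀ u → IsSup 𝐔 (singleton u) u
  sup-singleton u = ⋀-𝟙 (λ x → ≤⇒𝟙≤⇒ ≈⇒⪯)
                  , ⋀-𝟙 (λ w → ≤⇒𝟙≤⇒ (⋀-lb _ u ▸ ⇒-𝟙-antecedent (≡𝟙⇒𝟙≤ (≈-refl u))))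

  pair : U → U → U → L
  pair a b x = (x ≈ a) ∨ (x ≈ b)

  pair-∋ˡ : ∀ {a b} → 𝟙 ≤ pair a b a
  pair-∋ˡ {a} = ≡𝟙⇒𝟙≤ (≈-refl a) ▸ ∨-ub₁ _ _

  pair-∋ʳ : ∀ {a b} → 𝟙 ≤ pair a b b
  pair-∋ʳ {b = b} = ≡𝟙⇒𝟙≤ (≈-refl b) ▸ ∨-ub₂ _ _

  infixr 30 _⊓_
  infixr 29 _⊔_
  _⊓_ _⊔_ : U → U → U
  a ⊓ b = inf (pair a b)
  a ⊔ b = sup (pair a b)

  x⊓y⊑x : ∀ {a b} → a ⊓ b ⊑ a
  x⊓y⊑x {a} {b} = pair-∋ˡ ▸ inf-lower 𝐔 (inf-isInf (pair a b)) a

  x⊓y⊑y : ∀ {a b} → a ⊓ b ⊑ b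
  x⊓y⊑y {a} {b} = pair-∋ʳ ▸ inf-lower 𝐔 (inf-isInf (pair a b)) b

  ⊓-greatest : ∀ {a b w} → (w ⪯ a) ∧ (w ⪯ b) ≤ w ⪯ a ⊓ b
  ⊓-greatest {a} {b} {w} =
    ≤-⋀⇒ (λ x → ⊗-∨-lub (⊗-mono (∧-lb₁ _ _) ≈⇒⪰ ▸ ⪯-trans′) (⊗-mono (∧-lb₂ _ _) ≈⇒⪰ ▸ ⪯-trans′))
    ▸ inf-greatest 𝐔 (inf-isInf (pair a b)) w

  x⊑x⊔y : ∀ {a b} → a ⊑ a ⊔ b
  x⊑x⊔y {a} {b} = pair-∋ˡ ▸ sup-upper 𝐔 (sup-isSup (pair a b)) a

  y⊑x⊔y : ∀ {a b} → b ⊑ a ⊔ b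
  y⊑x⊔y {a} {b} = pair-∋ʳ ▸ sup-upper 𝐔 (sup-isSup (pair a b)) b

  ⊔-least : ∀ {a b w} → (a ⪯ w) ∧ (b ⪯ w) ≤ a ⊔ b ⪯ w
  ⊔-least {a} {b} {w} =
    ≤-⋀⇒ (λ x → ⊗-∨-lub (⊗-comm-≤ ▸ ⊗-mono ≈⇒⪯ (∧-lb₁ _ _) ▸ ⪯-trans′)
                        (⊗-comm-≤ ▸ ⊗-mono ≈⇒⪯ (∧-lb₂ _ _) ▸ ⪯-trans′))
    ▸ sup-least 𝐔 (sup-isSup (pair a b)) w

  module FromCompleteTolerance (R : LRel) (isCTol : IsCTol R) where
    R-refl : IsReflexive R
    R-refl = proj₁ (proj₁ isCTol)

    R-sym : IsSymmetric R
    R-sym = proj₂ (proj₁ isCTol)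

    R-compat : IsCompatible R
    R-compat = proj₁ (proj₂ isCTol)

    R-inf : ∀ V₁ V₂ → (R ⁺) V₁ V₂ ≤ R (inf V₁ , inf V₂)
    R-inf = proj₁ (proj₂ (proj₂ isCTol))

    R-sup : ∀ V₁ V₂ → (R ⁺) V₁ V₂ ≤ R (sup V₁ , sup V₂)
    R-sup = proj₂ (proj₂ (proj₂ isCTol))

    R-respˡ : ∀ {a c x} → R (a , c) ⊗ (a ≈ x) ≤ R (x , c)
    R-respˡ {a} {c} {x} = 𝟙≤⇒≤⊗ʳ (≡𝟙⇒𝟙≤ (≈-refl c)) ▸ R-compat a c x c

    R-respʳ : ∀ {a c y} → R (a , c) ⊗ (c ≈ y) ≤ R (a , y)
    R-respʳ {a} {c} {y} = ⊗-monoˡ (𝟙≤⇒≤⊗ʳ (≡𝟙⇒𝟙≤ (≈-refl a))) ▸ R-compat a c a y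

    ≤-∘ʳ : ∀ {e x c} {V : U → L} → e ≤ R (x , c) → 𝟙 ≤ V c → e ≤ (R ∘ʳ V) x
    ≤-∘ʳ {c = c} p q = p ▸ 𝟙≤⇒≤⊗ʳ q ▸ ⋁-ub _ c

    ≤-∘ˡ : ∀ {e a y} {V : U → L} → e ≤ R (a , y) → 𝟙 ≤ V a → e ≤ (V ∘ˡ R) y
    ≤-∘ˡ {a = a} p q = p ▸ 𝟙≤⇒≤⊗ˡ q ▸ ⋁-ub _ a

    ⁺-pair : ∀ {e a b c d} → e ≤ R (a , c) → e ≤ R (b , d) → e ≤ (R ⁺) (pair a b) (pair c d)
    ⁺-pair {a = a} {b} {c} {d} p q = ∧-glb _ _ _
      (≤-⋀⇒ (λ x → ⊗-∨-lub (≤-∘ʳ (⊗-mono p (≤-reflexive (≈-sym x a)) ▸ R-respˡ) pair-∋ˡ)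
                           (≤-∘ʳ (⊗-mono q (≤-reflexive (≈-sym x b)) ▸ R-respˡ) pair-∋ʳ)))
      (≤-⋀⇒ (λ y → ⊗-∨-lub (≤-∘ˡ (⊗-mono p (≤-reflexive (≈-sym y c)) ▸ R-respʳ) pair-∋ˡ)
                           (≤-∘ˡ (⊗-mono q (≤-reflexive (≈-sym y d)) ▸ R-respʳ) pair-∋ʳ)))

    ⁺-singleton-class : ∀ u → 𝟙 ≤ (R ⁺) (singleton u) (class R u)
    ⁺-singleton-class u = ∧-glb _ _ _
      (≤-⋀⇒ (λ x → ≤-∘ʳ (x⊗y≤y ▸ ≤-reflexive (≈-sym x u) ▸ 𝟙≤⇒≤⊗ˡ Ruu ▸ R-respˡ) Ruu))
      (≤-⋀⇒ (λ y → ≤-∘ˡ x⊗y≤y (≡𝟙⇒𝟙≤ (≈-refl u))))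
      where
      Ruu : 𝟙 ≤ R (u , u)
      Ruu = ≡𝟙⇒𝟙≤ (R-refl u)

    f g : U → U
    f = lower R
    g = upper R

    R-lower : ∀ u → 𝟙 ≤ R (u , f u)
    R-lower u = ⁺-singleton-class u ▸ R-inf (singleton u) (class R u)
              ▸ ≤-reflexive (cong (λ z → R (z , f u)) (inf-unique (inf-isInf _) (inf-singleton u)))

    R-upper : ∀ u → 𝟙 ≤ R (u , g u)
    R-upper u = ⁺-singleton-class u ▸ R-sup (singleton u) (class R u)
              ▸ ≤-reflexive (cong (λ z → R (z , g u)) (sup-unique (sup-isSup _) (sup-singleton u)))

    R≤lower⪯ : ∀ {u v} → R (u , v) ≤ f u ⪯ v
    R≤lower⪯ {u} {v} = inf-lower 𝐔 (inf-isInf (class R u)) v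

    R≤⪯upper : ∀ {u v} → R (u , v) ≤ v ⪯ g u
    R≤⪯upper {u} {v} = sup-upper 𝐔 (sup-isSup (class R u)) v

    -- Completeness on the pairs {x, y} and {z, y} gives R (x , z) ≤ R (x ⊔ y , z ⊔ y),
    -- and x ⊔ y equals y to degree x ⪯ y.
    upper-isotone : ∀ x y → x ⪯ y ≤ g x ⪯ g y
    upper-isotone x y = ≤-⋀⇒ bound ▸ sup-least 𝐔 (sup-isSup (class R x)) (g y)
      where
      R-⊔ : ∀ {z} → R (x , z) ≤ R (x ⊔ y , z ⊔ y)
      R-⊔ = ⁺-pair ≤-refl (𝟙-max _ ▸ ≡𝟙⇒𝟙≤ (R-refl y)) ▸ R-sup (pair x y) (pair _ y)
      ⊔-≈ : x ⪯ y ≤ x ⊔ y ≈ y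
      ⊔-≈ = ≤-≈ (∧-glb _ _ _ ≤-refl (𝟙-max _ ▸ ⊑-refl y) ▸ ⊔-least) (𝟙-max _ ▸ y⊑x⊔y)
      bound : ∀ z → (x ⪯ y) ⊗ R (x , z) ≤ z ⪯ g y
      bound z = ⊗-comm-≤ ▸ ⊗-mono R-⊔ ⊔-≈ ▸ R-respˡ ▸ R≤⪯upper ▸ ⊑-⪯-trans x⊑x⊔y

    lower-isotone : ∀ x y → x ⪯ y ≤ f x ⪯ f y
    lower-isotone x y = ≤-⋀⇒ bound ▸ inf-greatest 𝐔 (inf-isInf (class R y)) (f x)
      where
      R-⊓ : ∀ {z} → R (y , z) ≤ R (x ⊓ y , x ⊓ z)
      R-⊓ = ⁺-pair (𝟙-max _ ▸ ≡𝟙⇒𝟙≤ (R-refl x)) ≤-refl ▸ R-inf (pair x y) (pair x _)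
      ⊓-≈ : x ⪯ y ≤ x ⊓ y ≈ x
      ⊓-≈ = ≤-≈ (𝟙-max _ ▸ x⊓y⊑x) (∧-glb _ _ _ (𝟙-max _ ▸ ⊑-refl x) ≤-refl ▸ ⊓-greatest)
      bound : ∀ z → (x ⪯ y) ⊗ R (y , z) ≤ f x ⪯ z
      bound z = ⊗-comm-≤ ▸ ⊗-mono R-⊓ ⊓-≈ ▸ R-respˡ ▸ R≤lower⪯ ▸ ⪯-⊑-trans x⊓y⊑y

    isIGal : IsIGal (f , g)
    isIGal u v = ≤-antisym
      (upper-isotone (f u) v ▸ ⊑-⪯-trans (R-lower u ▸ ≤-reflexive (R-sym u (f u)) ▸ R≤⪯upper))
      (lower-isotone u (g v) ▸ ⪯-⊑-trans (R-upper v ▸ ≤-reflexive (R-sym v (g v)) ▸ R≤lower⪯))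

    isExtensive : IsExtensive (f , g)
    isExtensive = (λ u → 𝟙≤⇒≡𝟙 (≡𝟙⇒𝟙≤ (R-refl u) ▸ R≤lower⪯))
                , (λ u → 𝟙≤⇒≡𝟙 (≡𝟙⇒𝟙≤ (R-refl u) ▸ R≤⪯upper))

    -- Completeness on pairs gives R (u , w) = 1 for w = (g u ⊓ v) ⊔ f u, and w ≈ v holds
    -- to degree (f u ⪯ v) ∧ (v ⪯ g u).
    toTol-toGal≤ : ∀ u v → toTol (f , g) (u , v) ≤ R (u , v)
    toTol-toGal≤ u v = 𝟙≤⇒≤⊗ˡ R-u-w ▸ ⊗-monoʳ w≈v ▸ R-compat u w u v
      where
      w : U
      w = (g u ⊓ v) ⊔ f u
      R-⊓ : 𝟙 ≤ R (u ⊓ v , g u ⊓ v)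
      R-⊓ = ⁺-pair (R-upper u) (≡𝟙⇒𝟙≤ (R-refl v)) ▸ R-inf (pair u v) (pair (g u) v)
      R-⊔ : 𝟙 ≤ R ((u ⊓ v) ⊔ u , w)
      R-⊔ = ⁺-pair R-⊓ (R-lower u) ▸ R-sup (pair (u ⊓ v) u) (pair (g u ⊓ v) (f u))
      absorb : (u ⊓ v) ⊔ u ≡ u
      absorb = ⊑-antisym (∧-glb _ _ _ x⊓y⊑x (⊑-refl u) ▸ ⊔-least) y⊑x⊔y
      R-u-w : 𝟙 ≤ R (u , w) ⊗ (u ≈ u)
      R-u-w = R-⊔ ▸ ≤-reflexive (cong (λ z → R (z , w)) absorb) ▸ 𝟙≤⇒≤⊗ʳ (≡𝟙⇒𝟙≤ (≈-refl u))
      w≈v : toTol (f , g) (u , v) ≤ w ≈ v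
      w≈v = ≤-≈ (∧-glb _ _ _ (𝟙-max _ ▸ x⊓y⊑y) (∧-lb₁ _ _) ▸ ⊔-least)
                (∧-glb _ _ _ (∧-lb₂ _ _) (𝟙-max _ ▸ ⊑-refl v) ▸ ⊓-greatest ▸ ⪯-⊑-trans x⊑x⊔y)

    toTol-toGal : ∀ p → toTol (f , g) p ≡ R p
    toTol-toGal (u , v) = ≤-antisym (toTol-toGal≤ u v) (∧-glb _ _ _ R≤lower⪯ R≤⪯upper)

  module FromExtensiveGalois (f g : U → U) (isEIGal : IsEIGal (f , g)) where
    galois : ∀ u v → (f u ⪯ v) ≡ (u ⪯ g v)
    galois = proj₁ isEIGal

    f-isotone : ∀ a b → a ⪯ b ≤ f a ⪯ f b
    f-isotone a b = 𝟙≤⇒≤⊗ʳ (⊑-refl (f b) ▸ ≤-reflexive (galois b (f b)))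
                  ▸ ⪯-trans′ ▸ ≤-reflexive (sym (galois a (f b)))

    g-isotone : ∀ a b → a ⪯ b ≤ g a ⪯ g b
    g-isotone a b = 𝟙≤⇒≤⊗ˡ (⊑-refl (g a) ▸ ≤-reflexive (sym (galois (g a) a)))
                  ▸ ⪯-trans′ ▸ ≤-reflexive (galois (g a) b)

    f⊑id : ∀ u → f u ⊑ u
    f⊑id u = ≡𝟙⇒𝟙≤ (proj₁ (proj₂ isEIGal) u)

    id⊑g : ∀ u → u ⊑ g u
    id⊑g u = ≡𝟙⇒𝟙≤ (proj₂ (proj₂ isEIGal) u)

    f⊑g : ∀ u → f u ⊑ g u
    f⊑g u = f⊑id u ▸ ⪯-⊑-trans (id⊑g u)

    T : LRel
    T = toTol (f , g)

    T-isTolerance : IsTolerance T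
    T-isTolerance = (λ u → 𝟙≤⇒≡𝟙 (∧-glb _ _ _ (f⊑id u) (id⊑g u)))
                  , (λ u v → trans (cong₂ _∧_ (galois u v) (sym (galois v u))) (∧-comm _ _))

    T-compat : IsCompatible T
    T-compat u v u' v' = ∧-glb _ _ _
      (⊗-mono (⊗-mono (∧-lb₁ _ _) (≈⇒⪰ ▸ f-isotone u' u)) ≈⇒⪯ ▸ ⊗-monoˡ (⊗-comm-≤ ▸ ⪯-trans′) ▸ ⪯-trans′)
      (⊗-mono (⊗-mono (∧-lb₂ _ _) (≈⇒⪯ ▸ g-isotone u u')) ≈⇒⪰ ▸ ⊗-monoˡ ⪯-trans′ ▸ ⊗-comm-≤ ▸ ⪯-trans′)

    module _ (V₁ V₂ : U → L) where
      ⁺-∘ʳ : ∀ x → (T ⁺) V₁ V₂ ⊗ V₁ x ≤ (T ∘ʳ V₂) x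
      ⁺-∘ʳ = ⋀⇒-elim (∧-lb₁ _ _)

      ⁺-∘ˡ : ∀ y → (T ⁺) V₁ V₂ ⊗ V₂ y ≤ (V₁ ∘ˡ T) y
      ⁺-∘ˡ = ⋀⇒-elim (∧-lb₂ _ _)

      T-inf : (T ⁺) V₁ V₂ ≤ T (inf V₁ , inf V₂)
      T-inf = ∧-glb _ _ _
        (≤-⋀⇒ (λ y → ⁺-∘ˡ y ▸ ⋁-lub _ _ (λ x →
               ⊗-mono (inf-lower 𝐔 (inf-isInf V₁) x ▸ f-isotone (inf V₁) x) (∧-lb₁ _ _) ▸ ⪯-trans′))
          ▸ inf-greatest 𝐔 (inf-isInf V₂) (f (inf V₁)))
        (≤-⋀⇒ (λ x → ⁺-∘ʳ x ▸ ⋁-lub _ _ (λ y →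
               ⊗-comm-≤ ▸ ⊗-mono (inf-lower 𝐔 (inf-isInf V₂) y ▸ f-isotone (inf V₂) y)
                                 (∧-lb₂ _ _ ▸ ≤-reflexive (sym (galois y x))) ▸ ⪯-trans′))
          ▸ inf-greatest 𝐔 (inf-isInf V₁) (f (inf V₂)) ▸ ≤-reflexive (galois (inf V₂) (inf V₁)))

      T-sup : (T ⁺) V₁ V₂ ≤ T (sup V₁ , sup V₂)
      T-sup = ∧-glb _ _ _
        (≤-⋀⇒ (λ x → ⁺-∘ʳ x ▸ ⋁-lub _ _ (λ y →
               ⊗-mono (∧-lb₁ _ _ ▸ ≤-reflexive (galois x y))
                      (sup-upper 𝐔 (sup-isSup V₂) y ▸ g-isotone y (sup V₂)) ▸ ⪯-trans′))
          ▸ sup-least 𝐔 (sup-isSup V₁) (g (sup V₂)) ▸ ≤-reflexive (sym (galois (sup V₁) (sup V₂))))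
        (≤-⋀⇒ (λ y → ⁺-∘ˡ y ▸ ⋁-lub _ _ (λ x →
               ⊗-comm-≤ ▸ ⊗-mono (∧-lb₂ _ _) (sup-upper 𝐔 (sup-isSup V₁) x ▸ g-isotone x (sup V₁))
               ▸ ⪯-trans′))
          ▸ sup-least 𝐔 (sup-isSup V₂) (g (sup V₁)))

    T-isCTol : IsCTol T
    T-isCTol = T-isTolerance , T-compat , T-inf , T-sup

    lower-toTol : ∀ u → lower T u ≡ f u
    lower-toTol u = ⊑-antisym
      (∧-glb _ _ _ (⊑-refl (f u)) (f⊑g u) ▸ inf-lower 𝐔 (inf-isInf (class T u)) (f u))
      (⋀-glb _ _ (λ v → ≤⇒𝟙≤⇒ (∧-lb₁ _ _)) ▸ inf-greatest 𝐔 (inf-isInf (class T u)) (f u))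

    upper-toTol : ∀ u → upper T u ≡ g u
    upper-toTol u = ⊑-antisym
      (⋀-glb _ _ (λ v → ≤⇒𝟙≤⇒ (∧-lb₂ _ _)) ▸ sup-least 𝐔 (sup-isSup (class T u)) (g u))
      (∧-glb _ _ _ (f⊑g u) (⊑-refl (g u)) ▸ sup-upper 𝐔 (sup-isSup (class T u)) (g u))

  CTolCarrier EIGalCarrier : Set
  CTolCarrier = RawLOrd.Carrier CTol
  EIGalCarrier = RawLOrd.Carrier EIGal

  toGal-isEIGal : ∀ R → IsCTol R → IsEIGal (toGal R)
  toGal-isEIGal R isCTol = isIGal , isExtensive
    where open FromCompleteTolerance R isCTol

  toTol-isCTol : ∀ p → IsEIGal p → IsCTol (toTol p)
  toTol-isCTol (f , g) = FromExtensiveGalois.T-isCTol f g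

  CTol-isLOrdered : IsLOrdered CTol
  CTol-isLOrdered = isLOrdered-fromSymmetrised CTol
    (record { refl = λ _ → refl ; sym = λ e p → sym (e p) ; trans = λ e e' p → trans (e p) (e' p) })
    S-cong (λ _ _ → refl) (λ R → 𝟙≤⇒≡𝟙 (S-refl (proj₁ R))) (λ _ _ _ → S-trans) (λ _ _ → S-antisym)

  ⁺-mono : ∀ {M R : LRel} {c} → (∀ p → M p ⊗ c ≤ R p) → ∀ A B → (M ⁺) A B ⊗ c ≤ (R ⁺) A B
  ⁺-mono M⊗c≤R A B = ∧-glb _ _ _
    (≤-⋀⇒ (λ x → ⊗-swapʳ ▸ ⊗-monoˡ (⋀⇒-elim (∧-lb₁ _ _) x)
                 ▸ adj← (⋁-lub _ _ (λ y → adj→ (⊗-swapʳ ▸ ⊗-monoˡ (M⊗c≤R (x , y)) ▸ ⋁-ub _ y)))))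
    (≤-⋀⇒ (λ y → ⊗-swapʳ ▸ ⊗-monoˡ (⋀⇒-elim (∧-lb₂ _ _) y)
                 ▸ adj← (⋁-lub _ _ (λ x → adj→ (⊗-assocʳ ▸ ⊗-monoʳ (M⊗c≤R (x , y)) ▸ ⋁-ub _ x)))))

  module Tol (R : CTolCarrier) = FromCompleteTolerance (proj₁ R) (proj₂ R)

  module CTolMeet (V : CTolCarrier → L) where
    M : LRel
    M p = ⋀ (λ R → V R ⇒ proj₁ R p)

    M⊗V≤ : ∀ R p → M p ⊗ V R ≤ proj₁ R p
    M⊗V≤ R p = ⋀⇒-elim ≤-refl R

    M-isCTol : IsCTol M
    M-isCTol =
        ( (λ x → ⋀-𝟙 (λ R → ≤⇒𝟙≤⇒ (𝟙-max _ ▸ ≡𝟙⇒𝟙≤ (Tol.R-refl R x))))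
        , (λ x y → ⋀-cong (λ R → cong (V R ⇒_) (Tol.R-sym R x y))) )
      , (λ u v u' v' → ≤-⋀⇒ (λ R → ⊗-swapʳ ▸ ⊗-monoˡ ⊗-swapʳ ▸ ⊗-monoˡ (⊗-monoˡ (M⊗V≤ R _))
                                  ▸ Tol.R-compat R u v u' v'))
      , (λ V₁ V₂ → ≤-⋀⇒ (λ R → ⁺-mono (M⊗V≤ R) V₁ V₂ ▸ Tol.R-inf R V₁ V₂))
      , (λ V₁ V₂ → ≤-⋀⇒ (λ R → ⁺-mono (M⊗V≤ R) V₁ V₂ ▸ Tol.R-sup R V₁ V₂))

    M-isInf : IsInf CTol V (M , M-isCTol)
    M-isInf = ⋀-𝟙 (λ R → ≤⇒𝟙≤⇒ (≤-⋀⇒ (λ p → ⊗-comm-≤ ▸ M⊗V≤ R p)))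
            , ⋀-𝟙 (λ W → ≤⇒𝟙≤⇒ (≤-⋀⇒ (λ p → ≤-⋀⇒ (λ R →
                ⊗-swapʳ ▸ ⊗-monoˡ (⋀⇒-elim ≤-refl R) ▸ ⋀⇒-elim ≤-refl p))))

  CTol-infs : ∀ V → Ext CTol V → Σ CTolCarrier (IsInf CTol V)
  CTol-infs V _ = (M , M-isCTol) , M-isInf
    where open CTolMeet V

  CTol-isCompletelyLatticeLOrdered : IsCompletelyLatticeLOrdered CTol
  CTol-isCompletelyLatticeLOrdered = record
    { isLOrdered = CTol-isLOrdered
    ; inf        = CTol-infs
    ; sup        = sups-from-infs CTol CTol-isLOrdered CTol-infs
    }

  _⪯ᶠ_ : (U → U) → (U → U) → L
  h ⪯ᶠ k = ⋀ (λ u → h u ⪯ k u)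

  ⪯ᶠ-refl : ∀ h → 𝟙 ≤ h ⪯ᶠ h
  ⪯ᶠ-refl h = ⋀-glb _ _ (λ u → ⊑-refl (h u))

  ⪯ᶠ-trans : ∀ {h k l} → (h ⪯ᶠ k) ⊗ (k ⪯ᶠ l) ≤ h ⪯ᶠ l
  ⪯ᶠ-trans = ⋀-glb _ _ (λ u → ⊗-mono (⋀-lb _ u) (⋀-lb _ u) ▸ ⪯-trans′)

  ⪯ᶠ-antisym : ∀ {h k} → 𝟙 ≤ h ⪯ᶠ k → 𝟙 ≤ k ⪯ᶠ h → ∀ u → h u ≡ k u
  ⪯ᶠ-antisym p q u = ⊑-antisym (p ▸ ⋀-lb _ u) (q ▸ ⋀-lb _ u)

  open RawLOrd EIGal using () renaming (_≐_ to _≐ᴱ_; _≈_ to _≈ᴱ_; _⪯_ to _⪯ᴱ_)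

  EIGal-≈-symmetrised : ∀ p₁ p₂ → (p₁ ≈ᴱ p₂) ≡ (p₁ ⪯ᴱ p₂) ∧ (p₂ ⪯ᴱ p₁)
  EIGal-≈-symmetrised ((f₁ , g₁) , _) ((f₂ , g₂) , _) = begin
      ⋀ (λ u → f₂ u ≈ f₁ u) ∧ ⋀ (λ v → g₁ v ≈ g₂ v)
    ≡⟨ cong₂ _∧_ (⋀-cong (λ u → ≈-symmetrised _ _)) (⋀-cong (λ v → ≈-symmetrised _ _)) ⟩
      ⋀ (λ u → (f₂ u ⪯ f₁ u) ∧ (f₁ u ⪯ f₂ u)) ∧ ⋀ (λ v → (g₁ v ⪯ g₂ v) ∧ (g₂ v ⪯ g₁ v))
    ≡⟨ cong₂ _∧_ (⋀-∧ _ _) (⋀-∧ _ _) ⟩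
      ((f₂ ⪯ᶠ f₁) ∧ (f₁ ⪯ᶠ f₂)) ∧ ((g₁ ⪯ᶠ g₂) ∧ (g₂ ⪯ᶠ g₁))
    ≡⟨ ∧-interchange _ _ _ _ ⟩
      ((f₂ ⪯ᶠ f₁) ∧ (g₁ ⪯ᶠ g₂)) ∧ ((f₁ ⪯ᶠ f₂) ∧ (g₂ ⪯ᶠ g₁))
    ∎
    where open ≡-Reasoning

  EIGal-isLOrdered : IsLOrdered EIGal
  EIGal-isLOrdered = isLOrdered-fromSymmetrised EIGal
    (record
      { refl  = (λ _ → refl) , (λ _ → refl)
      ; sym   = λ (ef , eg) → (λ u → sym (ef u)) , (λ u → sym (eg u))
      ; trans = λ (ef , eg) (ef' , eg') → (λ u → trans (ef u) (ef' u)) , (λ u → trans (eg u) (eg' u))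
      })
    (λ (ef , eg) (ef' , eg') → cong₂ _∧_ (⋀-cong (λ u → cong₂ _⪯_ (ef' u) (ef u)))
                                         (⋀-cong (λ v → cong₂ _⪯_ (eg v) (eg' v))))
    EIGal-≈-symmetrised
    (λ _ → 𝟙≤⇒≡𝟙 (∧-glb _ _ _ (⪯ᶠ-refl _) (⪯ᶠ-refl _)))
    (λ _ _ _ → ∧-glb _ _ _ (⊗-comm-≤ ▸ ⊗-mono (∧-lb₁ _ _) (∧-lb₁ _ _) ▸ ⪯ᶠ-trans)
                           (⊗-mono (∧-lb₂ _ _) (∧-lb₂ _ _) ▸ ⪯ᶠ-trans))
    (λ _ _ p₁⪯p₂ p₂⪯p₁ → ⪯ᶠ-antisym (p₂⪯p₁ ▸ ∧-lb₁ _ _) (p₁⪯p₂ ▸ ∧-lb₁ _ _)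
                       , ⪯ᶠ-antisym (p₁⪯p₂ ▸ ∧-lb₂ _ _) (p₂⪯p₁ ▸ ∧-lb₂ _ _))

  S-≤-lower⪯ᶠ : ∀ R₁ R₂ → S (proj₁ R₁) (proj₁ R₂) ≤ Tol.f R₂ ⪯ᶠ Tol.f R₁
  S-≤-lower⪯ᶠ R₁ R₂ =
    ⋀-glb _ _ (λ u → ⋀-lb _ (u , Tol.f R₁ u) ▸ ⇒-𝟙-antecedent (Tol.R-lower R₁ u) ▸ Tol.R≤lower⪯ R₂)

  S-≤-⪯ᶠupper : ∀ R₁ R₂ → S (proj₁ R₁) (proj₁ R₂) ≤ Tol.g R₁ ⪯ᶠ Tol.g R₂
  S-≤-⪯ᶠupper R₁ R₂ =
    ⋀-glb _ _ (λ v → ⋀-lb _ (v , Tol.g R₁ v) ▸ ⇒-𝟙-antecedent (Tol.R-upper R₁ v) ▸ Tol.R≤⪯upper R₂)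

  toTol-antitone : ∀ f₁ g₁ f₂ g₂ → (f₂ ⪯ᶠ f₁) ∧ (g₁ ⪯ᶠ g₂) ≤ S (toTol (f₁ , g₁)) (toTol (f₂ , g₂))
  toTol-antitone _ _ _ _ = ≤-⋀⇒ λ (u , v) → ∧-glb _ _ _
    (⊗-mono (∧-lb₁ _ _ ▸ ⋀-lb _ u) (∧-lb₁ _ _) ▸ ⪯-trans′)
    (⊗-comm-≤ ▸ ⊗-mono (∧-lb₂ _ _) (∧-lb₂ _ _ ▸ ⋀-lb _ u) ▸ ⪯-trans′)

  toTol-resp : ∀ {p₁ p₂} → p₁ ≐ᴱ p₂ → ∀ q → toTol (proj₁ p₁) q ≡ toTol (proj₁ p₂) q
  toTol-resp (ef , eg) (u , v) = cong₂ _∧_ (cong (_⪯ v) (ef u)) (cong (v ⪯_) (eg u))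

  toGal-isIso : IsIso CTol EIGal (φ toGal-isEIGal) (ψ toTol-isCTol)
  toGal-isIso = record
    { h-resp    = λ e → (λ u → inf-cong (λ v → e (u , v))) , (λ u → sup-cong (λ v → e (u , v)))
    ; h'-resp   = λ {p₁} {p₂} → toTol-resp {p₁} {p₂}
    ; left-inv  = λ R → Tol.toTol-toGal R
    ; right-inv = λ ((f , g) , e) → FromExtensiveGalois.lower-toTol f g e
                                  , FromExtensiveGalois.upper-toTol f g e
    ; ⪯-pres    = λ R₁ R₂ → ≤-antisym (∧-glb _ _ _ (S-≤-lower⪯ᶠ R₁ R₂) (S-≤-⪯ᶠupper R₁ R₂))
        (toTol-antitone _ _ _ _ ▸ ≤-reflexive (S-cong (Tol.toTol-toGal R₁) (Tol.toTol-toGal R₂)))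
    }

  EIGal-infs : ∀ V → Ext EIGal V → Σ EIGalCarrier (IsInf EIGal V)
  EIGal-infs = infs-transport toGal-isIso EIGal-isLOrdered CTol-infs

  EIGal-isCompletelyLatticeLOrdered : IsCompletelyLatticeLOrdered EIGal
  EIGal-isCompletelyLatticeLOrdered = record
    { isLOrdered = EIGal-isLOrdered
    ; inf        = EIGal-infs
    ; sup        = sups-from-infs EIGal EIGal-isLOrdered EIGal-infs
    }

theorem16 : (𝐋 : CRL) → let open Over 𝐋 in
    (U : Set) (_≈_ _⪯_ : U → U → L)
    (cl : IsCompletelyLatticeLOrdered (rawU U _≈_ _⪯_)) →
    let open OnU U _≈_ _⪯_ cl in
    Σ[ wG ∈ (∀ R → IsCTol R → IsEIGal (toGal R)) ]
    Σ[ wT ∈ (∀ p → IsEIGal p → IsCTol (toTol p)) ]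
      IsIso CTol EIGal (φ wG) (ψ wT)
      × IsCompletelyLatticeLOrdered CTol
      × IsCompletelyLatticeLOrdered EIGal
theorem16 𝐋 U _≈_ _⪯_ cl =
    toGal-isEIGal
  , toTol-isCTol
  , toGal-isIso
  , CTol-isCompletelyLatticeLOrdered
  , EIGal-isCompletelyLatticeLOrdered
  where open CompletelyLatticeLOrdered 𝐋 U _≈_ _⪯_ cl
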